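{- Let $k\ge1$ and let $w\in\{a^kb,a^{k+1}b\}^*\cup\{ab^k,ab^{k+1}\}^*$. Let $u$ be the derivative of $w$, i.e. $u=\varphi_k^{ -1}(w)$ if $w\in\{a^kb,a^{k+1}b\}^*$ and $u=\hat\varphi_k^{ -1}(w)$ if $w\in\{ab^k,ab^{k+1}\}^*$. If $u$ is a Christoffel word, then $w$ is a proper Christoffel word.
   Context: Alphabet $\{a,b\}$. The palindromization map $\psi$ is defined by $\psi(\varepsilon)=\varepsilon$ and $\psi(ux)=(\psi(u)x)^{(+)}$ for a word $u$ and letter $x$, where $z^{(+)}$ is the shortest palindrome having $z$ as prefix. A Christoffel word is either a letter $a$ or $b$ or a word $a\psi(v)b$ with $v\in\{a,b\}^*$; the latter are called proper. For $k\ge0$, $\varphi_k$ is the injective morphism $a\mapsto a^{k+1}b$, $b\mapsto a^kb$, and $\hat\varphi_k$ is the injective morphism $a\mapsto ab^k$, $b\mapsto ab^{k+1}$; $\varphi_k^{ -1}(w)$ denotes the unique word $u$ with $\varphi_k(u)=w$ (similarly for $\hat\varphi_k$). -}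

module Defs where

open import Data.Nat using (ℕ; zero; suc; _+_; _≤_)
open import Data.List using (List; []; _∷_; _++_; _∷ʳ_; reverse; replicate; concatMap; length)
open import Data.Product using (Σ; ∃; _×_; _,_)
open import Data.Sum using (_⊎_)
open import Relation.Binary.PropositionalEquality using (_≡_)

data Letter : Set where
  a b : Letter

Word : Set
Word = List Letter

Palindrome : Word → Set
Palindrome w = reverse w ≡ w

IsPrefix : Word → Word → Set
IsPrefix z p = ∃ λ t → z ++ t ≡ p

IsPalClosure : Word → Word → Set
IsPalClosure z q =
  Palindrome q × IsPrefix z q ×
  (∀ r → Palindrome r → IsPrefix z r → length q ≤ length r)

data Psi : Word → Word → Set where
  psi-ε    : Psi [] []
  psi-snoc : ∀ {u p q} (x : Letter) →
             Psi u p → IsPalClosure (p ∷ʳ x) q → Psi (u ∷ʳ x) q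

ProperChristoffel : Word → Set
ProperChristoffel w = ∃ λ v → ∃ λ p → Psi v p × w ≡ a ∷ (p ∷ʳ b)

Christoffel : Word → Set
Christoffel w = (w ≡ a ∷ []) ⊎ (w ≡ b ∷ []) ⊎ ProperChristoffel w

φ-letter : ℕ → Letter → Word
φ-letter k a = replicate (suc k) a ++ b ∷ []
φ-letter k b = replicate k a ++ b ∷ []

φ : ℕ → Word → Word
φ k = concatMap (φ-letter k)

φ̂-letter : ℕ → Letter → Word
φ̂-letter k a = a ∷ replicate k b
φ̂-letter k b = a ∷ replicate (suc k) b

φ̂ : ℕ → Word → Word
φ̂ k = concatMap (φ̂-letter k)

-- With G = φ̂₀ : a ↦ a, b ↦ ab and D̃ = φ₀ : a ↦ ab, b ↦ b one has φ_{k+1} = G ∘ φ_k and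
-- φ̂_{k+1} = D̃ ∘ φ̂_k, so it suffices that G and D̃ map proper Christoffel words to proper
-- Christoffel words, and that φ₁, φ̂₁ send the letters a, b to proper ones (aab, ab, ab, abb).
-- For G this is Justin's formula ψ(av) = G(ψ(v)) a, since G(a ψ(v) b) = a (G(ψ(v)) a) b; it is
-- proved by computing palindromic closures as z⁽⁺⁾ = z (reverse s), where z = s t with t the
-- longest palindromic suffix of z, and lifting palindromic suffixes of G-images back through G.
-- For D̃ it follows from the case of G by exchanging the letters a and b.
module Submission where

open import Defs
open import Data.Nat using (ℕ; zero; suc; _+_; _≤_; s≤s)
open import Data.Nat.Properties
  using ( ≤-trans; ≤-reflexive; +-cancelˡ-≤; +-monoʳ-≤; +-monoˡ-≤; ≤-total; m+1+n≰m
        ; module ≤-Reasoning)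
open import Data.List
  using (List; []; _∷_; _++_; _∷ʳ_; reverse; replicate; length; map; concatMap; initLast; _∷ʳ′_)
open import Data.List.Properties
  using ( ∷-injective; ∷-injectiveʳ; length-++; length-++-≤ˡ; length-reverse; length-map
        ; ++-assoc; ++-cancelʳ; ++-identityʳ; ∷ʳ-++; ∷ʳ-injectiveˡ; ∷ʳ-injectiveʳ
        ; reverse-++; reverse-involutive; unfold-reverse; reverse-map
        ; map-++; map-∘; map-cong; map-id; concatMap-++; concatMap-cong)
open import Data.List.Effectful using (module MonadProperties)
open import Function using (_∘_)
open import Data.Product using (∃; ∃₂; _×_; _,_)
open import Data.Sum using (inj₁; inj₂)
open import Data.Empty using (⊥-elim)
open import Relation.Binary.PropositionalEquality

++-split : {A : Set} (xs ys us vs : List A) → xs ++ ys ≡ us ++ vs → length xs ≤ length us →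
           ∃ λ m → us ≡ xs ++ m × ys ≡ m ++ vs
++-split []       ys us       vs eq _         = us , refl , eq
++-split (x ∷ xs) ys (u ∷ us) vs eq (s≤s le) with refl , eq′ ← ∷-injective eq
  with m , us≡ , ys≡ ← ++-split xs ys us vs eq′ le = m , cong (x ∷_) us≡ , ys≡

concatMap-∘ : {A B C : Set} (f : B → List C) (g : A → List B) (u : List A) →
  concatMap f (concatMap g u) ≡ concatMap (concatMap f ∘ g) u
concatMap-∘ f g u = sym (MonadProperties.associative u g f)

palindrome-sandwich : ∀ s t → Palindrome t → Palindrome (s ++ t ++ reverse s)
palindrome-sandwich s t pal = begin
  reverse (s ++ t ++ reverse s)                   ≡⟨ reverse-++ s (t ++ reverse s) ⟩
  reverse (t ++ reverse s) ++ reverse s           ≡⟨ cong (_++ reverse s) (reverse-++ t (reverse s)) ⟩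
  (reverse (reverse s) ++ reverse t) ++ reverse s ≡⟨ cong₂ (λ u v → (u ++ v) ++ reverse s)
                                                            (reverse-involutive s) pal ⟩
  (s ++ t) ++ reverse s                           ≡⟨ ++-assoc s t (reverse s) ⟩
  s ++ t ++ reverse s                             ∎
  where open ≡-Reasoning

palindromic-suffix-head≡last : ∀ {c d r} s x → Palindrome (c ∷ r) → s ++ c ∷ r ≡ x ∷ʳ d → c ≡ d
palindromic-suffix-head≡last {c} {d} {r} s x pal eq = ∷ʳ-injectiveʳ (s ++ reverse r) x (begin
  (s ++ reverse r) ∷ʳ c ≡⟨ ++-assoc s (reverse r) (c ∷ []) ⟩
  s ++ reverse r ∷ʳ c   ≡⟨ cong (s ++_) (sym (unfold-reverse c r)) ⟩
  s ++ reverse (c ∷ r)  ≡⟨ cong (s ++_) pal ⟩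
  s ++ c ∷ r            ≡⟨ eq ⟩
  x ∷ʳ d                ∎)
  where open ≡-Reasoning

reverse-wrap : ∀ (x : Letter) (w : Word) → reverse (x ∷ w ∷ʳ x) ≡ x ∷ reverse w ∷ʳ x
reverse-wrap x w = trans (unfold-reverse x (w ∷ʳ x)) (cong (_∷ʳ x) (reverse-++ w (x ∷ [])))

palindrome-unwrap : ∀ (x : Letter) (w : Word) → Palindrome (x ∷ w ∷ʳ x) → Palindrome w
palindrome-unwrap x w pal = ∷ʳ-injectiveˡ (reverse w) w (∷-injectiveʳ (trans (sym (reverse-wrap x w)) pal))

palindrome-wrap : ∀ (x : Letter) (w : Word) → Palindrome w → Palindrome (x ∷ w ∷ʳ x)
palindrome-wrap x w pal = trans (reverse-wrap x w) (cong (λ u → x ∷ u ∷ʳ x) pal)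

PalSuffixCut : Word → Word → Set
PalSuffixCut z s = ∃ λ t → s ++ t ≡ z × Palindrome t

ShortestPalSuffixCut : Word → Word → Set
ShortestPalSuffixCut z s = PalSuffixCut z s × (∀ s′ → PalSuffixCut z s′ → length s ≤ length s′)

PalSuffixCut-length : ∀ {z s} → PalSuffixCut z s → length s ≤ length z
PalSuffixCut-length {s = s} (t , refl , _) = length-++-≤ˡ s

PalSuffixCut⇒palindrome : ∀ {z s} → PalSuffixCut z s → Palindrome (z ++ reverse s)
PalSuffixCut⇒palindrome {s = s} (t , refl , pal) =
  subst Palindrome (sym (++-assoc s t (reverse s))) (palindrome-sandwich s t pal)

palindrome⇒PalSuffixCut : ∀ z t → Palindrome (z ++ t) → length t ≤ length z → PalSuffixCut z (reverse t)
palindrome⇒PalSuffixCut z t pal le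
  with m , z≡ , reverse-z≡ ← ++-split (reverse t) (reverse z) z t
         (trans (sym (reverse-++ z t)) pal) (≤-trans (≤-reflexive (length-reverse t)) le)
  = m , sym z≡ , ++-cancelʳ t (reverse m) m (begin
      reverse m ++ t                    ≡⟨ cong (reverse m ++_) (sym (reverse-involutive t)) ⟩
      reverse m ++ reverse (reverse t)  ≡⟨ sym (reverse-++ (reverse t) m) ⟩
      reverse (reverse t ++ m)          ≡⟨ cong reverse (sym z≡) ⟩
      reverse z                         ≡⟨ reverse-z≡ ⟩
      m ++ t                            ∎)
  where open ≡-Reasoning

length-++-reverse : ∀ (z s : Word) → length (z ++ reverse s) ≡ length z + length s
length-++-reverse z s = trans (length-++ z) (cong (length z +_) (length-reverse s))

IsPalClosure⇒ShortestPalSuffixCut : ∀ {z q} → IsPalClosure z q →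
  ∃ λ s → ShortestPalSuffixCut z s × q ≡ z ++ reverse s
IsPalClosure⇒ShortestPalSuffixCut {z} {q} (pal , (t , refl) , shortest) =
  reverse t , (cut , cut-shortest) , cong (z ++_) (sym (reverse-involutive t))
  where
  t-shortest : ∀ s′ → PalSuffixCut z s′ → length t ≤ length s′
  t-shortest s′ cut′ = +-cancelˡ-≤ (length z) _ _ (begin
    length z + length t  ≡⟨ length-++ z {t} ⟨
    length (z ++ t)      ≤⟨ shortest _ (PalSuffixCut⇒palindrome cut′) (reverse s′ , refl) ⟩
    length (z ++ reverse s′) ≡⟨ length-++-reverse z s′ ⟩
    length z + length s′ ∎)
    where open ≤-Reasoning
  cut : PalSuffixCut z (reverse t)
  cut = palindrome⇒PalSuffixCut z t pal (t-shortest z ([] , ++-identityʳ z , refl))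
  cut-shortest : ∀ s′ → PalSuffixCut z s′ → length (reverse t) ≤ length s′
  cut-shortest s′ cut′ = ≤-trans (≤-reflexive (length-reverse t)) (t-shortest s′ cut′)

ShortestPalSuffixCut⇒IsPalClosure : ∀ {z s} → ShortestPalSuffixCut z s → IsPalClosure z (z ++ reverse s)
ShortestPalSuffixCut⇒IsPalClosure {z} {s} (cut , shortest) =
  PalSuffixCut⇒palindrome cut , (reverse s , refl) , minimal
  where
  minimal : ∀ r → Palindrome r → IsPrefix z r → length (z ++ reverse s) ≤ length r
  minimal r pal (t , refl) = subst₂ _≤_ (sym (length-++-reverse z s)) (sym (length-++ z {t}))
    (+-monoʳ-≤ (length z) s≤t)
    where
    s≤t : length s ≤ length t
    s≤t with ≤-total (length t) (length z)
    ... | inj₁ t≤z = subst (length s ≤_) (length-reverse t) (shortest _ (palindrome⇒PalSuffixCut z t pal t≤z))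
    ... | inj₂ z≤t = ≤-trans (PalSuffixCut-length cut) z≤t

palindrome⇒IsPalClosure : ∀ {z} → Palindrome z → IsPalClosure z z
palindrome⇒IsPalClosure {z} pal = pal , ([] , ++-identityʳ z) , λ { _ _ (_ , refl) → length-++-≤ˡ z }

G : Word → Word
G = φ̂ 0

D̃ : Word → Word
D̃ = φ 0

Gᵃ : Word → Word
Gᵃ w = G w ∷ʳ a

G-++ : ∀ xs ys → G (xs ++ ys) ≡ G xs ++ G ys
G-++ = concatMap-++ (φ̂-letter 0)

D̃-++ : ∀ xs ys → D̃ (xs ++ ys) ≡ D̃ xs ++ D̃ ys
D̃-++ = concatMap-++ (φ-letter 0)

G-aⁿb : ∀ n → G (replicate n a ++ b ∷ []) ≡ a ∷ replicate n a ++ b ∷ []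
G-aⁿb zero    = refl
G-aⁿb (suc n) = cong (a ∷_) (G-aⁿb n)

D̃-bⁿ : ∀ n → D̃ (replicate n b) ≡ replicate n b
D̃-bⁿ zero    = refl
D̃-bⁿ (suc n) = cong (b ∷_) (D̃-bⁿ n)

φ-suc : ∀ k u → φ (suc k) u ≡ G (φ k u)
φ-suc k u = trans (concatMap-cong letter u) (sym (concatMap-∘ (φ̂-letter 0) (φ-letter k) u))
  where
  letter : ∀ c → φ-letter (suc k) c ≡ G (φ-letter k c)
  letter a = sym (G-aⁿb (suc k))
  letter b = sym (G-aⁿb k)

φ̂-suc : ∀ k u → φ̂ (suc k) u ≡ D̃ (φ̂ k u)
φ̂-suc k u = trans (concatMap-cong letter u) (sym (concatMap-∘ (φ-letter 0) (φ̂-letter k) u))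
  where
  letter : ∀ c → φ̂-letter (suc k) c ≡ D̃ (φ̂-letter k c)
  letter a = cong (λ u → a ∷ b ∷ u) (sym (D̃-bⁿ k))
  letter b = cong (λ u → a ∷ b ∷ u) (sym (D̃-bⁿ (suc k)))

G-∷ʳb : ∀ w → G (w ∷ʳ b) ≡ Gᵃ w ∷ʳ b
G-∷ʳb w = trans (G-++ w (b ∷ [])) (sym (∷ʳ-++ (G w) a (b ∷ [])))

a∷reverse-G : ∀ w → a ∷ reverse (G w) ≡ Gᵃ (reverse w)
a∷reverse-G [] = refl
a∷reverse-G (c ∷ w) = begin
  a ∷ reverse (φ̂-letter 0 c ++ G w)               ≡⟨ cong (a ∷_) (reverse-++ (φ̂-letter 0 c) (G w)) ⟩
  (a ∷ reverse (G w)) ++ reverse (φ̂-letter 0 c)   ≡⟨ cong (_++ reverse (φ̂-letter 0 c)) (a∷reverse-G w) ⟩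
  G (reverse w) ∷ʳ a ++ reverse (φ̂-letter 0 c)    ≡⟨ ∷ʳ-++ (G (reverse w)) a _ ⟩
  G (reverse w) ++ a ∷ reverse (φ̂-letter 0 c)     ≡⟨ cong (G (reverse w) ++_) (letter c) ⟩
  G (reverse w) ++ G (c ∷ []) ∷ʳ a                ≡⟨ ++-assoc (G (reverse w)) (G (c ∷ [])) (a ∷ []) ⟨
  (G (reverse w) ++ G (c ∷ [])) ∷ʳ a              ≡⟨ cong (_∷ʳ a) (G-++ (reverse w) (c ∷ [])) ⟨
  Gᵃ (reverse w ∷ʳ c)                             ≡⟨ cong Gᵃ (unfold-reverse c w) ⟨
  Gᵃ (reverse (c ∷ w))                            ∎
  where
  open ≡-Reasoning
  letter : ∀ c → a ∷ reverse (φ̂-letter 0 c) ≡ Gᵃ (c ∷ [])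
  letter a = refl
  letter b = refl

reverse-Gᵃ : ∀ w → reverse (Gᵃ w) ≡ Gᵃ (reverse w)
reverse-Gᵃ w = trans (reverse-++ (G w) (a ∷ [])) (a∷reverse-G w)

G-++-a∷reverse-G : ∀ z s → G z ++ a ∷ reverse (G s) ≡ Gᵃ (z ++ reverse s)
G-++-a∷reverse-G z s = begin
  G z ++ a ∷ reverse (G s)      ≡⟨ cong (G z ++_) (a∷reverse-G s) ⟩
  G z ++ G (reverse s) ∷ʳ a     ≡⟨ ++-assoc (G z) (G (reverse s)) (a ∷ []) ⟨
  (G z ++ G (reverse s)) ∷ʳ a   ≡⟨ cong (_∷ʳ a) (G-++ z (reverse s)) ⟨
  Gᵃ (z ++ reverse s)           ∎
  where open ≡-Reasoning

G-head≢b : ∀ w {r} → G w ≢ b ∷ r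
G-head≢b (a ∷ w) ()
G-head≢b (b ∷ w) ()

G-injective : ∀ x y → G x ≡ G y → x ≡ y
G-injective []      []      _  = refl
G-injective []      (a ∷ y) ()
G-injective []      (b ∷ y) ()
G-injective (a ∷ x) []      ()
G-injective (b ∷ x) []      ()
G-injective (a ∷ x) (a ∷ y) eq = cong (a ∷_) (G-injective x y (∷-injectiveʳ eq))
G-injective (b ∷ x) (b ∷ y) eq = cong (b ∷_) (G-injective x y (∷-injectiveʳ (∷-injectiveʳ eq)))
G-injective (a ∷ x) (b ∷ y) eq = ⊥-elim (G-head≢b x (∷-injectiveʳ eq))
G-injective (b ∷ x) (a ∷ y) eq = ⊥-elim (G-head≢b y (sym (∷-injectiveʳ eq)))

Gᵃ-injective : ∀ x y → Gᵃ x ≡ Gᵃ y → x ≡ y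
Gᵃ-injective x y eq = G-injective x y (∷ʳ-injectiveˡ (G x) (G y) eq)

Gᵃ-palindrome⁺ : ∀ {w} → Palindrome w → Palindrome (Gᵃ w)
Gᵃ-palindrome⁺ {w} pal = trans (reverse-Gᵃ w) (cong Gᵃ pal)

Gᵃ-palindrome⁻ : ∀ {w} → Palindrome (Gᵃ w) → Palindrome w
Gᵃ-palindrome⁻ {w} pal = Gᵃ-injective (reverse w) w (trans (sym (reverse-Gᵃ w)) pal)

b∷G-palindrome⁺ : ∀ t → Palindrome (b ∷ t) → Palindrome (b ∷ G t)
b∷G-palindrome⁺ t pal with initLast t
... | []       = refl
... | w ∷ʳ′ c with refl ← palindromic-suffix-head≡last [] (b ∷ w) pal refl =
  subst (λ u → Palindrome (b ∷ u)) (sym (G-∷ʳb w))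
    (palindrome-wrap b (Gᵃ w) (Gᵃ-palindrome⁺ (palindrome-unwrap b w pal)))

b∷G-palindrome⁻ : ∀ t → Palindrome (b ∷ G t) → Palindrome (b ∷ t)
b∷G-palindrome⁻ t pal with initLast t
... | []       = refl
... | w ∷ʳ′ a with () ← palindromic-suffix-head≡last [] (b ∷ G w) pal (cong (b ∷_) (G-++ w (a ∷ [])))
... | w ∷ʳ′ b = palindrome-wrap b w
  (Gᵃ-palindrome⁻ (palindrome-unwrap b (Gᵃ w) (subst (λ u → Palindrome (b ∷ u)) (G-∷ʳb w) pal)))

Gᵃ-split-before-a : ∀ z s′ r → s′ ++ a ∷ r ≡ Gᵃ z →
  ∃₂ λ s t → z ≡ s ++ t × s′ ≡ G s × a ∷ r ≡ Gᵃ t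
Gᵃ-split-before-a z       []              r eq = [] , z , refl , refl , eq
Gᵃ-split-before-a []      (_ ∷ [])        r ()
Gᵃ-split-before-a []      (_ ∷ _ ∷ _)     r ()
Gᵃ-split-before-a (a ∷ z) (c ∷ s′)        r eq
  with refl , eq′ ← ∷-injective eq
  with s , t , z≡ , s′≡ , t≡ ← Gᵃ-split-before-a z s′ r eq′
  = a ∷ s , t , cong (a ∷_) z≡ , cong (a ∷_) s′≡ , t≡
Gᵃ-split-before-a (b ∷ z) (c ∷ [])        r eq with refl , () ← ∷-injective eq
Gᵃ-split-before-a (b ∷ z) (c ∷ d ∷ s′)    r eq
  with refl , eq′ ← ∷-injective eq
  with refl , eq″ ← ∷-injective eq′
  with s , t , z≡ , s′≡ , t≡ ← Gᵃ-split-before-a z s′ r eq″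
  = b ∷ s , t , cong (b ∷_) z≡ , cong (λ u → a ∷ b ∷ u) s′≡ , t≡

G-split-before-b : ∀ z s′ r → s′ ++ b ∷ r ≡ G z →
  ∃₂ λ s t → z ≡ s ++ b ∷ t × s′ ≡ Gᵃ s × r ≡ G t
G-split-before-b []      []           r ()
G-split-before-b []      (_ ∷ _)      r ()
G-split-before-b (a ∷ z) []           r ()
G-split-before-b (b ∷ z) []           r ()
G-split-before-b (a ∷ z) (c ∷ s′)     r eq
  with refl , eq′ ← ∷-injective eq
  with s , t , z≡ , s′≡ , r≡ ← G-split-before-b z s′ r eq′
  = a ∷ s , t , cong (a ∷_) z≡ , cong (a ∷_) s′≡ , r≡
G-split-before-b (b ∷ z) (c ∷ [])     r eq
  with refl , eq′ ← ∷-injective eq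
  = [] , z , refl , refl , ∷-injectiveʳ eq′
G-split-before-b (b ∷ z) (c ∷ d ∷ s′) r eq
  with refl , eq′ ← ∷-injective eq
  with refl , eq″ ← ∷-injective eq′
  with s , t , z≡ , s′≡ , r≡ ← G-split-before-b z s′ r eq″
  = b ∷ s , t , cong (b ∷_) z≡ , cong (λ u → a ∷ b ∷ u) s′≡ , r≡

G-length-mono : ∀ {z} s t s′ t′ → s ++ t ≡ z → s′ ++ t′ ≡ z → length s ≤ length s′ →
  length (G s) ≤ length (G s′)
G-length-mono s t s′ t′ eq eq′ le
  with m , refl , _ ← ++-split s t s′ t′ (trans eq (sym eq′)) le
  = subst (λ u → length (G s) ≤ length u) (sym (G-++ s m)) (length-++-≤ˡ (G s))

Gᵃ-length-mono : ∀ {z} s t s′ t′ → s ++ t ≡ z → s′ ++ t′ ≡ z → length s ≤ length s′ →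
  length (Gᵃ s) ≤ length (Gᵃ s′)
Gᵃ-length-mono s t s′ t′ eq eq′ le = subst₂ _≤_ (sym (length-++ (G s))) (sym (length-++ (G s′)))
  (+-monoˡ-≤ 1 (G-length-mono s t s′ t′ eq eq′ le))

Gᵃ-IsPalClosure : ∀ {z q} → IsPalClosure z q → IsPalClosure (Gᵃ z) (Gᵃ q)
Gᵃ-IsPalClosure {z} cl
  with s , ((t , s++t≡z , pal) , shortest) , refl ← IsPalClosure⇒ShortestPalSuffixCut cl =
  subst (IsPalClosure (Gᵃ z)) closure≡ (ShortestPalSuffixCut⇒IsPalClosure (cut , cut-shortest))
  where
  cut : PalSuffixCut (Gᵃ z) (G s)
  cut = Gᵃ t , G-cut , Gᵃ-palindrome⁺ pal
    where
    G-cut : G s ++ Gᵃ t ≡ Gᵃ z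
    G-cut = trans (sym (++-assoc (G s) (G t) (a ∷ [])))
                  (cong (_∷ʳ a) (trans (sym (G-++ s t)) (cong G s++t≡z)))
  cut-shortest : ∀ s′ → PalSuffixCut (Gᵃ z) s′ → length (G s) ≤ length s′
  cut-shortest s′ ([] , eq , _) =
    ≤-trans (PalSuffixCut-length cut) (≤-reflexive (cong length (trans (sym eq) (++-identityʳ s′))))
  -- A nonempty palindromic suffix of Gᵃ z starts with a, hence is the Gᵃ-image of one of z.
  cut-shortest s′ (c ∷ r , eq , pal′)
    with refl ← palindromic-suffix-head≡last s′ (G z) pal′ eq
    with s₂ , t₂ , z≡ , s′≡ , t₂≡ ← Gᵃ-split-before-a z s′ r eq
    = subst (λ u → length (G s) ≤ length u) (sym s′≡) (G-length-mono s t s₂ t₂ s++t≡z (sym z≡) s≤s₂)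
    where
    s≤s₂ : length s ≤ length s₂
    s≤s₂ = shortest s₂ (t₂ , sym z≡ , Gᵃ-palindrome⁻ (subst Palindrome t₂≡ pal′))
  closure≡ : Gᵃ z ++ reverse (G s) ≡ Gᵃ (z ++ reverse s)
  closure≡ = trans (∷ʳ-++ (G z) a (reverse (G s))) (G-++-a∷reverse-G z s)

Gᵃ∷ʳb-IsPalClosure : ∀ {p q} → IsPalClosure (p ∷ʳ b) q → IsPalClosure (Gᵃ p ∷ʳ b) (Gᵃ q)
Gᵃ∷ʳb-IsPalClosure {p} cl with IsPalClosure⇒ShortestPalSuffixCut cl
-- b is a palindromic suffix of p ∷ʳ b, so the longest one is nonempty.
... | s , (([] , s≡ , _) , shortest) , _ = ⊥-elim (m+1+n≰m (length p) (begin
  length p + 1       ≡⟨ length-++ p ⟨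
  length (p ∷ʳ b)    ≡⟨ cong length (trans (sym s≡) (++-identityʳ s)) ⟩
  length s           ≤⟨ shortest p (b ∷ [] , refl , refl) ⟩
  length p           ∎))
  where open ≤-Reasoning
... | s , ((c ∷ t , s++t≡ , pal) , shortest) , refl
  with refl ← palindromic-suffix-head≡last s p pal s++t≡ =
  subst (IsPalClosure (Gᵃ p ∷ʳ b)) closure≡ (ShortestPalSuffixCut⇒IsPalClosure (cut , cut-shortest))
  where
  cut : PalSuffixCut (Gᵃ p ∷ʳ b) (Gᵃ s)
  cut = b ∷ G t , Gᵃ-cut , b∷G-palindrome⁺ t pal
    where
    open ≡-Reasoning
    Gᵃ-cut : Gᵃ s ++ b ∷ G t ≡ Gᵃ p ∷ʳ b
    Gᵃ-cut = begin
      Gᵃ s ++ b ∷ G t     ≡⟨ ∷ʳ-++ (G s) a (b ∷ G t) ⟩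
      G s ++ G (b ∷ t)    ≡⟨ G-++ s (b ∷ t) ⟨
      G (s ++ b ∷ t)      ≡⟨ cong G s++t≡ ⟩
      G (p ∷ʳ b)          ≡⟨ G-∷ʳb p ⟩
      Gᵃ p ∷ʳ b           ∎
  cut-shortest : ∀ s′ → PalSuffixCut (Gᵃ p ∷ʳ b) s′ → length (Gᵃ s) ≤ length s′
  cut-shortest s′ ([] , eq , _) =
    ≤-trans (PalSuffixCut-length cut) (≤-reflexive (cong length (trans (sym eq) (++-identityʳ s′))))
  -- A nonempty palindromic suffix of G (p ∷ʳ b) starts with b, hence is b ∷ G t₂ for a
  -- palindromic suffix b ∷ t₂ of p ∷ʳ b.
  cut-shortest s′ (c ∷ r , eq , pal′)
    with refl ← palindromic-suffix-head≡last s′ (Gᵃ p) pal′ eq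
    with s₂ , t₂ , p∷ʳb≡ , s′≡ , r≡ ← G-split-before-b (p ∷ʳ b) s′ r (trans eq (sym (G-∷ʳb p)))
    = subst (λ u → length (Gᵃ s) ≤ length u) (sym s′≡)
        (Gᵃ-length-mono s (b ∷ t) s₂ (b ∷ t₂) s++t≡ (sym p∷ʳb≡) s≤s₂)
    where
    s≤s₂ : length s ≤ length s₂
    s≤s₂ = shortest s₂ (b ∷ t₂ , sym p∷ʳb≡ , b∷G-palindrome⁻ t₂ (subst (λ u → Palindrome (b ∷ u)) r≡ pal′))
  closure≡ : (Gᵃ p ∷ʳ b) ++ reverse (Gᵃ s) ≡ Gᵃ ((p ∷ʳ b) ++ reverse s)
  closure≡ = trans (cong₂ _++_ (sym (G-∷ʳb p)) (reverse-++ (G s) (a ∷ [])))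
                   (G-++-a∷reverse-G (p ∷ʳ b) s)

Psi-a∷ : ∀ {v p} → Psi v p → Psi (a ∷ v) (Gᵃ p)
Psi-a∷ psi-ε = psi-snoc a psi-ε (palindrome⇒IsPalClosure refl)
Psi-a∷ (psi-snoc {p = p} a ψ cl) =
  psi-snoc a (Psi-a∷ ψ) (subst (λ z → IsPalClosure (z ∷ʳ a) _) (G-++ p (a ∷ [])) (Gᵃ-IsPalClosure cl))
Psi-a∷ (psi-snoc b ψ cl) = psi-snoc b (Psi-a∷ ψ) (Gᵃ∷ʳb-IsPalClosure cl)

exchange : Letter → Letter
exchange a = b
exchange b = a

exchange-involutive : ∀ x → exchange (exchange x) ≡ x
exchange-involutive a = refl
exchange-involutive b = refl

map-involutive : ∀ {A : Set} {f : A → A} → (∀ x → f (f x) ≡ x) → ∀ xs → map f (map f xs) ≡ xs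
map-involutive {f = f} inv xs = trans (sym (map-∘ xs)) (trans (map-cong inv xs) (map-id xs))

map-palindrome : ∀ f {q} → Palindrome q → Palindrome (map f q)
map-palindrome f {q} pal = trans (sym (reverse-map f q)) (cong (map f) pal)

map-IsPalClosure : ∀ {f} → (∀ x → f (f x) ≡ x) →
  ∀ {z q} → IsPalClosure z q → IsPalClosure (map f z) (map f q)
map-IsPalClosure {f} inv {z} {q} (pal , (t , refl) , shortest) =
  map-palindrome f pal , (map f t , sym (map-++ f z t)) , minimal
  where
  minimal : ∀ r → Palindrome r → IsPrefix (map f z) r → length (map f q) ≤ length r
  minimal r pal′ (t′ , refl) = subst₂ _≤_ (sym (length-map f q)) (length-map f r)
    (shortest _ (map-palindrome f pal′) (map f t′ , prefix))
    where
    prefix : z ++ map f t′ ≡ map f (map f z ++ t′)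
    prefix = trans (cong (_++ map f t′) (sym (map-involutive inv z))) (sym (map-++ f (map f z) t′))

Psi-map : ∀ {f} → (∀ x → f (f x) ≡ x) → ∀ {v p} → Psi v p → Psi (map f v) (map f p)
Psi-map inv psi-ε = psi-ε
Psi-map {f} inv (psi-snoc {u} {p} {q} x ψ cl) =
  subst (λ v → Psi v (map f q)) (sym (map-++ f u (x ∷ [])))
    (psi-snoc (f x) (Psi-map inv ψ)
      (subst (λ z → IsPalClosure z (map f q)) (map-++ f p (x ∷ [])) (map-IsPalClosure inv cl)))

map-exchange-Gᵃ-map-exchange : ∀ p → map exchange (Gᵃ (map exchange p)) ≡ b ∷ D̃ p
map-exchange-Gᵃ-map-exchange []      = refl
map-exchange-Gᵃ-map-exchange (a ∷ p) = cong (λ u → b ∷ a ∷ u) (map-exchange-Gᵃ-map-exchange p)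
map-exchange-Gᵃ-map-exchange (b ∷ p) = cong (b ∷_) (map-exchange-Gᵃ-map-exchange p)

Psi-b∷ : ∀ {v p} → Psi v p → Psi (b ∷ v) (b ∷ D̃ p)
Psi-b∷ {v} {p} ψ =
  subst₂ Psi (cong (b ∷_) (map-involutive exchange-involutive v)) (map-exchange-Gᵃ-map-exchange p)
    (Psi-map exchange-involutive (Psi-a∷ (Psi-map exchange-involutive ψ)))

ab-ProperChristoffel : ProperChristoffel (a ∷ b ∷ [])
ab-ProperChristoffel = [] , [] , psi-ε , refl

G-ProperChristoffel : ∀ {w} → ProperChristoffel w → ProperChristoffel (G w)
G-ProperChristoffel (v , p , ψ , refl) = a ∷ v , Gᵃ p , Psi-a∷ ψ , cong (a ∷_) (G-∷ʳb p)

D̃-ProperChristoffel : ∀ {w} → ProperChristoffel w → ProperChristoffel (D̃ w)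
D̃-ProperChristoffel (v , p , ψ , refl) =
  b ∷ v , b ∷ D̃ p , Psi-b∷ ψ , cong (λ u → a ∷ b ∷ u) (D̃-++ p (b ∷ []))

φ₁-ProperChristoffel : ∀ {u} → Christoffel u → ProperChristoffel (φ 1 u)
φ₁-ProperChristoffel (inj₁ refl)         = G-ProperChristoffel ab-ProperChristoffel
φ₁-ProperChristoffel (inj₂ (inj₁ refl))  = ab-ProperChristoffel
φ₁-ProperChristoffel {u} (inj₂ (inj₂ pc)) =
  subst ProperChristoffel (sym (φ-suc 0 u)) (G-ProperChristoffel (D̃-ProperChristoffel pc))

φ̂₁-ProperChristoffel : ∀ {u} → Christoffel u → ProperChristoffel (φ̂ 1 u)
φ̂₁-ProperChristoffel (inj₁ refl)         = ab-ProperChristoffel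
φ̂₁-ProperChristoffel (inj₂ (inj₁ refl))  = D̃-ProperChristoffel ab-ProperChristoffel
φ̂₁-ProperChristoffel {u} (inj₂ (inj₂ pc)) =
  subst ProperChristoffel (sym (φ̂-suc 0 u)) (D̃-ProperChristoffel (G-ProperChristoffel pc))

φ-ProperChristoffel : ∀ k {u} → Christoffel u → ProperChristoffel (φ (suc k) u)
φ-ProperChristoffel zero    c = φ₁-ProperChristoffel c
φ-ProperChristoffel (suc k) {u} c =
  subst ProperChristoffel (sym (φ-suc (suc k) u)) (G-ProperChristoffel (φ-ProperChristoffel k c))

φ̂-ProperChristoffel : ∀ k {u} → Christoffel u → ProperChristoffel (φ̂ (suc k) u)
φ̂-ProperChristoffel zero    c = φ̂₁-ProperChristoffel c
φ̂-ProperChristoffel (suc k) {u} c =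
  subst ProperChristoffel (sym (φ̂-suc (suc k) u)) (D̃-ProperChristoffel (φ̂-ProperChristoffel k c))

mainTheorem3 : (k : ℕ) → 1 ≤ k → (w u : Word) →
    ((φ k u ≡ w → Christoffel u → ProperChristoffel w)
     × (φ̂ k u ≡ w → Christoffel u → ProperChristoffel w))
mainTheorem3 (suc k) _ _ _ = (λ { refl → φ-ProperChristoffel k }) , (λ { refl → φ̂-ProperChristoffel k })
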